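{- Let $A$ be an ordered alphabet and $A^{\ast}$ the free monoid ordered by the Higman ordering. Let $Z$ be a non-empty antichain of $A^{\ast}$. If $\uparrow Z=XY$ with $X,Y$ final segments of $A^{\ast}$, then $X=\uparrow Min(X)$ and $Y=\uparrow Min(Y)$.
   Context: Higman ordering: $a_0\cdots a_{n-1}\le b_0\cdots b_{m-1}$ iff there is a strictly increasing $h$ with $a_i\le b_{h(i)}$ for all $i$. A final segment is an upward closed subset; an antichain is a set of pairwise incomparable words. $XY=\{\alpha\beta:\alpha\in X,\beta\in Y\}$, $\uparrow X:=\{\beta:\alpha\le\beta\text{ for some }\alpha\in X\}$, and $Min(X)$ is the set of minimal elements of $X$. -}

module Defs where

open import Level using (Level; _⊔_)
open import Data.List using (List; length; lookup; _++_)
open import Data.Fin using (Fin) renaming (_<_ to _<ᶠ_)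
open import Data.Product using (Σ; ∃; _×_)
open import Relation.Binary.Bundles using (Poset)
open import Relation.Binary.PropositionalEquality using (_≡_)
open import Relation.Unary using (Pred)
open import Data.List.Relation.Binary.Pointwise using (Pointwise)

module Higman {c ℓ₁ ℓ₂ : Level} (A : Poset c ℓ₁ ℓ₂) where
  open Poset A renaming (Carrier to Letter; _≤_ to _≤ₐ_; _≈_ to _≈ₐ_)

  Word : Set c
  Word = List Letter

  _≼_ : Word → Word → Set ℓ₂
  u ≼ v = Σ (Fin (length u) → Fin (length v)) λ h →
            (∀ i j → i <ᶠ j → h i <ᶠ h j) ×
            (∀ i → lookup u i ≤ₐ lookup v (h i))

  _≈w_ : Word → Word → Set (c ⊔ ℓ₁)
  u ≈w v = Pointwise _≈ₐ_ u v

  FinalSegment : {ℓ : Level} → Pred Word ℓ → Set (c ⊔ ℓ ⊔ ℓ₂)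
  FinalSegment X = ∀ u v → X u → u ≼ v → X v

  Antichain : {ℓ : Level} → Pred Word ℓ → Set (c ⊔ ℓ ⊔ ℓ₁ ⊔ ℓ₂)
  Antichain Z = ∀ u v → Z u → Z v → u ≼ v → u ≈w v

  NonEmpty : {ℓ : Level} → Pred Word ℓ → Set (c ⊔ ℓ)
  NonEmpty Z = ∃ λ z → Z z

  _·_ : {ℓ : Level} → Pred Word ℓ → Pred Word ℓ → Pred Word (c ⊔ ℓ)
  (X · Y) w = ∃ λ α → ∃ λ β → X α × Y β × (w ≡ α ++ β)

  ↑ : {ℓ : Level} → Pred Word ℓ → Pred Word (c ⊔ ℓ ⊔ ℓ₂)
  ↑ X β = ∃ λ α → X α × (α ≼ β)

  Min : {ℓ : Level} → Pred Word ℓ → Pred Word (c ⊔ ℓ ⊔ ℓ₂)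
  Min X x = X x × (∀ y → X y → y ≼ x → x ≼ y)

  _≐_ : {ℓ ℓ' : Level} → Pred Word ℓ → Pred Word ℓ' → Set (c ⊔ ℓ ⊔ ℓ')
  X ≐ Y = (∀ w → X w → Y w) × (∀ w → Y w → X w)

module Submission where

-- The combinatorial core is the overlap lemma: if αβ embeds into
-- xy, then α embeds into x, or β embeds into y with |β| < |y|; its mirror
-- image follows by reversing words.  Since Z is an antichain, nothing of ↑Z
-- lies strictly below an element of Z; hence in every factorisation αβ ∈ Z
-- with α ∈ X, β ∈ Y, both factors are minimal.  Fix such a factorisation
-- α₀β₀ of some z₀ ∈ Z.  For x ∈ X the word xβ₀ lies above some αβ ∈ Z; by the
-- overlap lemma either the minimal α embeds into x, or some β ∈ Y embeds into
-- β₀ while being shorter, contradicting minimality of β₀.  Symmetrically for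
-- Y, and the reverse inclusions hold because X and Y are final segments.

open import Defs
open import Level using (Level; _⊔_)
open import Function using (_∘_)
open import Data.Product using (_×_; _,_; Σ; proj₁; proj₂)
open import Data.Sum using (_⊎_; inj₁; inj₂; [_,_]′)
import Data.Sum as Sum
open import Data.Empty using (⊥-elim)
open import Relation.Binary.Bundles using (Poset)
open import Relation.Unary using (Pred)
open import Relation.Binary.PropositionalEquality using (_≡_; refl; subst; subst₂)
open import Data.List using ([]; _∷_; _++_; length; lookup; reverse)
open import Data.List.Properties using (reverse-++; length-reverse)
import Data.List.Relation.Binary.Pointwise as Pointwise
open import Data.List.Relation.Binary.Sublist.Heterogeneous
  using (Sublist; []; _∷_; _∷ʳ_; minimum)
open import Data.List.Relation.Binary.Sublist.Heterogeneous.Properties as Sublist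
  using (length-mono-≤; fromPointwise; ∷ˡ⁻; ++⁺; reverse⁺; reverse⁻)
open import Data.Fin using (Fin; zero; suc; toℕ)
open import Data.Nat using (ℕ; z≤n; s≤s) renaming (_≤_ to _≤ℕ_; _<_ to _<ℕ_)
open import Data.Nat.Properties using (≤-trans; <⇒≱; <-irrefl)

module HigmanEmbedding {c ℓ₁ ℓ₂ : Level} (A : Poset c ℓ₁ ℓ₂) where
  open Poset A using (reflexive; module Eq)
    renaming (Carrier to Letter; _≤_ to _≤ₐ_; refl to ≤ₐ-refl; trans to ≤ₐ-trans)
  open Higman A

  infix 4 _⊑_ _⊏_
  _⊑_ : Word → Word → Set (c ⊔ ℓ₂)
  _⊑_ = Sublist _≤ₐ_

  _⊏_ : Word → Word → Set (c ⊔ ℓ₂)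
  u ⊏ v = u ⊑ v × length u <ℕ length v

  ⊑-refl : ∀ {u} → u ⊑ u
  ⊑-refl = Sublist.refl ≤ₐ-refl

  ⊑-trans : ∀ {u v w} → u ⊑ v → v ⊑ w → u ⊑ w
  ⊑-trans = Sublist.trans ≤ₐ-trans

  ≈w⇒⊒ : ∀ {u v} → u ≈w v → v ⊑ u
  ≈w⇒⊒ = fromPointwise ∘ Pointwise.map reflexive ∘ Pointwise.symmetric Eq.sym

  ≼-[] : ∀ {v} → [] ≼ v
  ≼-[] = (λ ()) , (λ ()) , (λ ())

  ≼-skip : ∀ {u b v} → u ≼ v → u ≼ (b ∷ v)
  ≼-skip (h , mono , ok) = suc ∘ h , (λ i j i<j → s≤s (mono i j i<j)) , ok

  ≼-keep : ∀ {a b u v} → a ≤ₐ b → u ≼ v → (a ∷ u) ≼ (b ∷ v)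
  ≼-keep {a} {b} {u} {v} a≤b (h , mono , ok) = h′ , mono′ , ok′
    where
    h′ : Fin (length (a ∷ u)) → Fin (length (b ∷ v))
    h′ zero    = zero
    h′ (suc i) = suc (h i)
    mono′ : ∀ i j → toℕ i <ℕ toℕ j → toℕ (h′ i) <ℕ toℕ (h′ j)
    mono′ zero    (suc j) _         = s≤s z≤n
    mono′ (suc i) (suc j) (s≤s i<j) = s≤s (mono i j i<j)
    ok′ : ∀ i → lookup (a ∷ u) i ≤ₐ lookup (b ∷ v) (h′ i)
    ok′ zero    = a≤b
    ok′ (suc i) = ok i

  ⊑⇒≼ : ∀ {u v} → u ⊑ v → u ≼ v
  ⊑⇒≼ []                          = ≼-[] {[]}
  ⊑⇒≼ {u}     {b ∷ v} (b ∷ʳ p)    = ≼-skip {u} {b} {v} (⊑⇒≼ p)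
  ⊑⇒≼ {a ∷ u} {b ∷ v} (a≤b ∷ p)   = ≼-keep {a} {b} {u} {v} a≤b (⊑⇒≼ p)

  lower : ∀ {n} (k : Fin (ℕ.suc n)) → 0 <ℕ toℕ k → Fin n
  lower (suc k) _ = k

  lower-mono : ∀ {n} (k l : Fin (ℕ.suc n)) (p : 0 <ℕ toℕ k) (q : 0 <ℕ toℕ l) →
               toℕ k <ℕ toℕ l → toℕ (lower k p) <ℕ toℕ (lower l q)
  lower-mono (suc k) (suc l) _ _ (s≤s k<l) = k<l

  lookup-lower : ∀ {b : Letter} v (k : Fin (ℕ.suc (length v))) p →
                 lookup (b ∷ v) k ≡ lookup v (lower k p)
  lookup-lower v (suc k) _ = refl

  ≼-unskip : ∀ {u b v} (e : u ≼ (b ∷ v)) → (∀ i → 0 <ℕ toℕ (proj₁ e i)) → u ≼ v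
  ≼-unskip {v = v} (h , mono , ok) pos =
      (λ i → lower (h i) (pos i))
    , (λ i j i<j → lower-mono (h i) (h j) (pos i) (pos j) (mono i j i<j))
    , (λ i → subst (_ ≤ₐ_) (lookup-lower v (h i) (pos i)) (ok i))

  ≼-tail : ∀ {a u w} → (a ∷ u) ≼ w → u ≼ w
  ≼-tail (h , mono , ok) = h ∘ suc , (λ i j i<j → mono (suc i) (suc j) (s≤s i<j)) , ok ∘ suc

  tail-positive : ∀ {a u w} (e : (a ∷ u) ≼ w) → ∀ i → 0 <ℕ toℕ (proj₁ e (suc i))
  tail-positive (h , mono , _) i = ≤-trans (s≤s z≤n) (mono zero (suc i) (s≤s z≤n))

  -- ... and an index map yields an inductive embedding: position 0 is either
  -- hit by the first letter (keep) or by no letter at all (skip).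
  ≼⇒⊑ : ∀ {u v} → u ≼ v → u ⊑ v
  ≼⇒⊑ {[]}    {v}     _                = minimum v
  ≼⇒⊑ {a ∷ u} {[]}    (h , _)          with h zero
  ... | ()
  ≼⇒⊑ {a ∷ u} {b ∷ v} e@(h , _ , ok) with h zero in h0≡ | ok zero
  ... | zero  | a≤b = a≤b ∷ ≼⇒⊑ {u} {v} (≼-unskip {u} {b} {v} (≼-tail {a} e) (tail-positive e))
  ... | suc k | _   = b ∷ʳ ≼⇒⊑ {a ∷ u} {v} (≼-unskip {a ∷ u} {b} {v} e positive)
    where
    positive : ∀ i → 0 <ℕ toℕ (h i)
    positive zero    rewrite h0≡ = s≤s z≤n
    positive (suc i) = tail-positive e i

  drop-prefix : ∀ a p {s w} → (a ∷ p) ++ s ⊑ w → s ⊏ w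
  drop-prefix a []      q = ∷ˡ⁻ q , length-mono-≤ q
  drop-prefix a (b ∷ p) q = drop-prefix b p (∷ˡ⁻ q)

  overlapˡ : ∀ α {β} x {y} → α ++ β ⊑ x ++ y → α ⊑ x ⊎ β ⊏ y
  overlapˡ []      x       _           = inj₁ (minimum x)
  overlapˡ (a ∷ α) []      q           = inj₂ (drop-prefix a α q)
  overlapˡ (a ∷ α) (b ∷ x) (a≤b ∷ q)   = Sum.map₁ (a≤b ∷_) (overlapˡ α x q)
  overlapˡ (a ∷ α) (b ∷ x) (.b ∷ʳ q)   = Sum.map₁ (b ∷ʳ_) (overlapˡ (a ∷ α) x q)

  overlapʳ : ∀ α {β} x {y} → α ++ β ⊑ x ++ y → β ⊑ y ⊎ α ⊏ x
  overlapʳ α {β} x {y} q with overlapˡ (reverse β) (reverse y) reversed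
    where
    reversed : reverse β ++ reverse α ⊑ reverse y ++ reverse x
    reversed = subst₂ _⊑_ (reverse-++ α β) (reverse-++ x y) (reverse⁺ q)
  ... | inj₁ β⊑y             = inj₁ (reverse⁻ β⊑y)
  ... | inj₂ (α⊑x , |α|<|x|) =
        inj₂ (reverse⁻ α⊑x , subst₂ _<ℕ_ (length-reverse α) (length-reverse x) |α|<|x|)

  antichain-rigid : ∀ {ℓ} {Z : Pred Word ℓ} → Antichain Z →
                    ∀ {z w} → Z z → ↑ Z w → w ⊑ z → z ⊑ w
  antichain-rigid anti {z} {w} Zz (z′ , Zz′ , z′≼w) w⊑z =
    ⊑-trans (≈w⇒⊒ (anti z′ z Zz′ Zz (⊑⇒≼ (⊑-trans z′⊑w w⊑z)))) z′⊑w
    where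
    z′⊑w : z′ ⊑ w
    z′⊑w = ≼⇒⊑ {z′} {w} z′≼w

  Min-length : ∀ {ℓ} {S : Pred Word ℓ} {m s} → Min S m → S s → s ⊑ m → length m ≤ℕ length s
  Min-length {m = m} {s} (_ , minimal) Ss s⊑m =
    length-mono-≤ (≼⇒⊑ {m} {s} (minimal s Ss (⊑⇒≼ s⊑m)))

  ↑Min⊆ : ∀ {ℓ} {S : Pred Word ℓ} → FinalSegment S → ∀ w → ↑ (Min S) w → S w
  ↑Min⊆ final w (m , (Sm , _) , m≼w) = final m w Sm m≼w

  module Factorisation {ℓ : Level} (Z X Y : Pred Word ℓ) (antichain : Antichain Z)
                       (↑Z≐XY : ↑ Z ≐ (X · Y)) where

    XY⊆↑Z : ∀ {w} → (X · Y) w → ↑ Z w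
    XY⊆↑Z = proj₂ ↑Z≐XY _

    factor : ∀ {z} → Z z → (X · Y) z
    factor {z} Zz = proj₁ ↑Z≐XY z (z , Zz , ⊑⇒≼ (⊑-refl {z}))

    minimal-leftFactor : ∀ {α β} → Z (α ++ β) → X α → Y β → Min X α
    minimal-leftFactor {α} {β} Zαβ Xα Yβ = Xα , below
      where
      below : ∀ x → X x → x ≼ α → α ≼ x
      below x Xx x≼α =
        [ ⊑⇒≼ {α} {x} , (λ (_ , |β|<|β|) → ⊥-elim (<-irrefl refl |β|<|β|)) ]′
          (overlapˡ α x αβ⊑xβ)
        where
        αβ⊑xβ : α ++ β ⊑ x ++ β
        αβ⊑xβ = antichain-rigid antichain Zαβ (XY⊆↑Z {x ++ β} (x , β , Xx , Yβ , refl))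
                                (++⁺ (≼⇒⊑ {x} {α} x≼α) (⊑-refl {β}))

    minimal-rightFactor : ∀ {α β} → Z (α ++ β) → X α → Y β → Min Y β
    minimal-rightFactor {α} {β} Zαβ Xα Yβ = Yβ , below
      where
      below : ∀ y → Y y → y ≼ β → β ≼ y
      below y Yy y≼β =
        [ ⊑⇒≼ {β} {y} , (λ (_ , |α|<|α|) → ⊥-elim (<-irrefl refl |α|<|α|)) ]′
          (overlapʳ α α αβ⊑αy)
        where
        αβ⊑αy : α ++ β ⊑ α ++ y
        αβ⊑αy = antichain-rigid antichain Zαβ (XY⊆↑Z {α ++ y} (α , y , Xα , Yy , refl))
                                (++⁺ (⊑-refl {α}) (≼⇒⊑ {y} {β} y≼β))

    minimal-factorisation : ∀ {z} → Z z → Σ Word λ α → Σ Word λ β → Min X α × Min Y β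
    minimal-factorisation Zz with factor Zz
    ... | α , β , Xα , Yβ , refl =
          α , β , minimal-leftFactor Zz Xα Yβ , minimal-rightFactor Zz Xα Yβ

    X⊆↑MinX : ∀ {β₀} → Min Y β₀ → ∀ x → X x → ↑ (Min X) x
    X⊆↑MinX {β₀} minβ₀@(Yβ₀ , _) x Xx with XY⊆↑Z (x , β₀ , Xx , Yβ₀ , refl)
    ... | z , Zz , z≼xβ₀ with factor Zz
    ... | α , β , Xα , Yβ , refl with overlapˡ α x (≼⇒⊑ z≼xβ₀)
    ... | inj₁ α⊑x                = α , minimal-leftFactor Zz Xα Yβ , ⊑⇒≼ α⊑x
    ... | inj₂ (β⊑β₀ , |β|<|β₀|) = ⊥-elim (<⇒≱ |β|<|β₀| (Min-length minβ₀ Yβ β⊑β₀))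

    Y⊆↑MinY : ∀ {α₀} → Min X α₀ → ∀ y → Y y → ↑ (Min Y) y
    Y⊆↑MinY {α₀} minα₀@(Xα₀ , _) y Yy with XY⊆↑Z (α₀ , y , Xα₀ , Yy , refl)
    ... | z , Zz , z≼α₀y with factor Zz
    ... | α , β , Xα , Yβ , refl with overlapʳ α α₀ (≼⇒⊑ z≼α₀y)
    ... | inj₁ β⊑y                = β , minimal-rightFactor Zz Xα Yβ , ⊑⇒≼ β⊑y
    ... | inj₂ (α⊑α₀ , |α|<|α₀|) = ⊥-elim (<⇒≱ |α|<|α₀| (Min-length minα₀ Xα α⊑α₀))

lemma11 : {c ℓ₁ ℓ₂ ℓ : Level} (A : Poset c ℓ₁ ℓ₂) →
    let open Higman A in
    (Z X Y : Pred Word ℓ) →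
    NonEmpty Z → Antichain Z →
    FinalSegment X → FinalSegment Y →
    ↑ Z ≐ (X · Y) →
    (X ≐ ↑ (Min X)) × (Y ≐ ↑ (Min Y))
lemma11 A Z X Y (z₀ , Zz₀) antichain finalX finalY ↑Z≐XY =
  let open HigmanEmbedding A
      open Factorisation Z X Y antichain ↑Z≐XY
      (α₀ , β₀ , minα₀ , minβ₀) = minimal-factorisation Zz₀
  in (X⊆↑MinX minβ₀ , ↑Min⊆ finalX) , (Y⊆↑MinY minα₀ , ↑Min⊆ finalY)
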